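{- Let $\Sigma=\{a_1<\cdots<a_k\}\subset\mathbb{Z}$ and let $C\ge 1$. Let $\mathbf{x}$ be a $C$-balanced infinite word over $\Sigma$. Then the additive complexity of $\mathbf{x}$ is bounded by a constant; more precisely, $\rho^{\mathrm{add}}_{\mathbf{x}}(n)\le C\sum_{i=1}^{\lceil k/2\rceil}(a_{k+1-i}-a_i)+1$ for all $n\ge 0$.
   Context: For a finite word $w$ and letter $a$, $|w|_a$ is the number of occurrences of $a$ in $w$. An infinite word $\mathbf{x}$ is $C$-balanced if $\big||u|_a-|v|_a\big|\le C$ for every letter $a\in\Sigma$ and all factors (contiguous blocks) $u,v$ of $\mathbf{x}$ with $|u|=|v|$. Two words $u,v$ are additively equivalent if $|u|=|v|$ and $\sum_{a\in\Sigma}a|u|_a=\sum_{a\in\Sigma}a|v|_a$. The additive complexity $\rho^{\mathrm{add}}_{\mathbf{x}}(n)$ is the number of additive equivalence classes among the length-$n$ factors of $\mathbf{x}$. -}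

module Defs where

open import Data.Nat as ℕ using (ℕ; zero; suc; _<_; _<?_)
open import Data.Nat.Base using (_/_)
open import Data.Fin using (Fin; fromℕ<)
open import Data.Integer as ℤ using (ℤ; +_; _-_; ∣_∣)
open import Data.Integer.Properties using () renaming (_≟_ to _≟ℤ_)
open import Data.List using (List; map; upTo; length; filter)
import Data.List as L
open import Data.Product using (_×_)
open import Relation.Binary.PropositionalEquality using (_≡_)
open import Relation.Nullary using (yes; no)

occ : List ℤ → ℤ → ℕ
occ w b = length (filter (_≟ℤ b) w)

-- weight Σ_a a·|w|_a  (= sum of the letters of w)
weight : List ℤ → ℤ
weight w = L.foldr ℤ._+_ (+ 0) w

AddEquiv : List ℤ → List ℤ → Set
AddEquiv u v = (length u ≡ length v) × (weight u ≡ weight v)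

-- an infinite word over Σ = {a 0 < ... < a (k-1)} is given by x : ℕ → Fin k
-- (the letter at position j is a (x j)).
-- factor of length n starting at position i
factor : ∀ {k} → (Fin k → ℤ) → (ℕ → Fin k) → ℕ → ℕ → List ℤ
factor a x i n = map (λ j → a (x (i ℕ.+ j))) (upTo n)

Balanced : ∀ {k} → ℕ → (Fin k → ℤ) → (ℕ → Fin k) → Set
Balanced C a x = ∀ (l : Fin _) (i j n : ℕ) →
  ∣ (+ occ (factor a x i n) (a l)) - (+ occ (factor a x j n) (a l)) ∣ ℕ.≤ C

StrictlyIncreasing : ∀ {k} → (Fin k → ℤ) → Set
StrictlyIncreasing a = ∀ i j → i Data.Fin.< j → a i ℤ.< a j

-- a as a function on ℕ (value 0 outside the range; only used inside it)
at : ∀ {k} → (Fin k → ℤ) → ℕ → ℤ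
at {k} a j with j <? k
... | yes p = a (fromℕ< p)
... | no _ = + 0

sumBelow : ℕ → (ℕ → ℤ) → ℤ
sumBelow zero f = + 0
sumBelow (suc m) f = sumBelow m f ℤ.+ f m

-- C · Σ_{i=1}^{⌈k/2⌉} (a_{k+1-i} - a_i) + 1   (1-based in the paper; 0-based here)
bound : ∀ {k} → ℕ → (Fin k → ℤ) → ℤ
bound {k} C a =
  (+ C) ℤ.* sumBelow ((suc k) / 2) (λ i → at a (k ℕ.∸ suc i) - at a i) ℤ.+ (+ 1)

-- ρ^add_x(n) ≤ B : every family of pairwise additively inequivalent
-- length-n factors (given by starting positions) has at most B members
AddComplexity≤ : ∀ {k} → (Fin k → ℤ) → (ℕ → Fin k) → ℕ → ℤ → Set
AddComplexity≤ a x n B =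
  (ps : List ℕ) →
  Data.List.Relation.Unary.AllPairs.AllPairs
    (λ i j → AddEquiv (factor a x i n) (factor a x j n) → Data.Empty.⊥) ps →
  (+ length ps) ℤ.≤ B
  where import Data.List.Relation.Unary.AllPairs
        import Data.Empty

{-# OPTIONS --safe #-}
-- Write c_u(t) for the number of occurrences of the t-th letter a_t in u. For factors u, v of
-- the same length the differences d_t = c_u(t) − c_v(t) sum to zero and satisfy |d_t| ≤ C, so
-- for any centre M the weight difference is Σ_t a_t d_t = Σ_t (a_t − M) d_t ≤ C Σ_t |a_t − M|.
-- Choosing M to be the median letter, the deviations pair up as (M − a_i) + (a_{k−1−i} − M),
-- giving C Σ_{i<⌈k/2⌉} (a_{k−1−i} − a_i). Weights of length-n factors therefore lie in an
-- integer interval of that width, and additively inequivalent factors have distinct weights.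
module Submission where

open import Defs
open import Data.Nat using (ℕ; _≤_)
open import Data.Fin using (Fin)
open import Data.Integer using (ℤ)

open import Data.Nat as ℕ using (zero; suc; z≤n; s≤s; z<s; _<_; _∸_; _/_; ⌊_/2⌋; ⌈_/2⌉)
import Data.Nat.Properties as ℕP
open import Data.Nat.DivMod using (m/n≡1+[m∸n]/n)
open import Data.Integer as ℤ using (+_; -[1+_]; 0ℤ; _-_; ∣_∣; +≤+; -≤+)
import Data.Integer.Properties as ℤP
open import Data.Integer.Tactic.RingSolver using (solve-∀)
open import Algebra.Properties.AbelianGroup ℤP.+-0-abelianGroup using (∙-cancelʳ)
open import Algebra.Properties.CommutativeSemigroup ℤP.+-commutativeSemigroup using (interchange)
open import Data.Fin as Fin using (toℕ; fromℕ<)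
import Data.Fin.Properties as FinP
open import Data.List using (List; []; _∷_; [_]; _++_; map; upTo; length; lookup; filter)
import Data.List.Properties as ListP
open import Data.List.Relation.Unary.All as All using (All; _∷_)
open import Data.List.Relation.Unary.AllPairs as AllPairs using (AllPairs; _∷_)
open import Data.List.Membership.Propositional.Properties using (∈-lookup)
open import Data.List.Extrema ℤP.≤-totalOrder using (argmin; f[argmin]≤f[⊤]; f[argmin]≤f[xs])
open import Data.Product using (_×_; _,_; proj₁; proj₂)
open import Data.Sum using (inj₁; inj₂)
open import Function using (_∘_)
open import Function.Definitions using (Injective)
open import Relation.Binary.PropositionalEquality using (_≡_; _≢_; refl; sym; trans; cong; cong₂; subst; subst₂; module ≡-Reasoning)
open import Relation.Binary.Definitions using (tri<; tri≈; tri>)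
open import Relation.Nullary using (yes; no; contradiction)

sumBelow-cong : ∀ m {f g : ℕ → ℤ} → (∀ t → t < m → f t ≡ g t) → sumBelow m f ≡ sumBelow m g
sumBelow-cong zero    f≡g = refl
sumBelow-cong (suc m) f≡g =
  cong₂ ℤ._+_ (sumBelow-cong m (λ t t<m → f≡g t (ℕP.m<n⇒m<1+n t<m))) (f≡g m ℕP.≤-refl)

sumBelow-mono-≤ : ∀ m {f g : ℕ → ℤ} → (∀ t → t < m → f t ℤ.≤ g t) →
                  sumBelow m f ℤ.≤ sumBelow m g
sumBelow-mono-≤ zero    f≤g = ℤP.≤-refl
sumBelow-mono-≤ (suc m) f≤g =
  ℤP.+-mono-≤ (sumBelow-mono-≤ m (λ t t<m → f≤g t (ℕP.m<n⇒m<1+n t<m))) (f≤g m ℕP.≤-refl)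

sumBelow-zero : ∀ m {f : ℕ → ℤ} → (∀ t → t < m → f t ≡ 0ℤ) → sumBelow m f ≡ 0ℤ
sumBelow-zero zero    f≡0 = refl
sumBelow-zero (suc m) f≡0 =
  cong₂ ℤ._+_ (sumBelow-zero m (λ t t<m → f≡0 t (ℕP.m<n⇒m<1+n t<m))) (f≡0 m ℕP.≤-refl)

sumBelow-single : ∀ m {f : ℕ → ℤ} p → p < m → (∀ t → t < m → t ≢ p → f t ≡ 0ℤ) →
                  sumBelow m f ≡ f p
sumBelow-single (suc m) {f} p p<1+m others with p ℕP.≟ m
... | yes refl = trans (cong (ℤ._+ f p) (sumBelow-zero m below)) (ℤP.+-identityˡ (f p))
  where
  below : ∀ t → t < p → f t ≡ 0ℤ
  below t t<p = others t (ℕP.m<n⇒m<1+n t<p) (ℕP.<⇒≢ t<p)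
... | no p≢m = trans (cong₂ ℤ._+_ rest (others m ℕP.≤-refl (p≢m ∘ sym))) (ℤP.+-identityʳ (f p))
  where
  rest : sumBelow m f ≡ f p
  rest = sumBelow-single m p (ℕP.≤∧≢⇒< (ℕ.s≤s⁻¹ p<1+m) p≢m)
           (λ t t<m → others t (ℕP.m<n⇒m<1+n t<m))

sumBelow-suc-head : ∀ m (f : ℕ → ℤ) → sumBelow (suc m) f ≡ f 0 ℤ.+ sumBelow m (f ∘ suc)
sumBelow-suc-head zero    f = trans (ℤP.+-identityˡ (f 0)) (sym (ℤP.+-identityʳ (f 0)))
sumBelow-suc-head (suc m) f =
  trans (cong (ℤ._+ f (suc m)) (sumBelow-suc-head m f)) (ℤP.+-assoc (f 0) _ _)

sumBelow-distrib-+ : ∀ m (f g : ℕ → ℤ) →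
                     sumBelow m (λ t → f t ℤ.+ g t) ≡ sumBelow m f ℤ.+ sumBelow m g
sumBelow-distrib-+ zero    f g = refl
sumBelow-distrib-+ (suc m) f g =
  trans (cong (ℤ._+ (f m ℤ.+ g m)) (sumBelow-distrib-+ m f g))
        (interchange (sumBelow m f) (sumBelow m g) (f m) (g m))

sumBelow-distrib-- : ∀ m (f g : ℕ → ℤ) →
                     sumBelow m (λ t → f t - g t) ≡ sumBelow m f - sumBelow m g
sumBelow-distrib-- zero    f g = refl
sumBelow-distrib-- (suc m) f g =
  trans (cong (ℤ._+ (f m - g m)) (sumBelow-distrib-- m f g))
        (regroup (sumBelow m f) (sumBelow m g) (f m) (g m))
  where
  regroup : ∀ a b c d → (a - b) ℤ.+ (c - d) ≡ (a ℤ.+ c) - (b ℤ.+ d)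
  regroup = solve-∀

sumBelow-*ˡ : ∀ m (c : ℤ) (f : ℕ → ℤ) → sumBelow m (λ t → c ℤ.* f t) ≡ c ℤ.* sumBelow m f
sumBelow-*ˡ zero    c f = sym (ℤP.*-zeroʳ c)
sumBelow-*ˡ (suc m) c f =
  trans (cong (ℤ._+ c ℤ.* f m) (sumBelow-*ˡ m c f)) (sym (ℤP.*-distribˡ-+ c _ _))

sumBelow-centre : ∀ m (A d : ℕ → ℤ) (M : ℤ) → sumBelow m d ≡ 0ℤ →
                  sumBelow m (λ t → A t ℤ.* d t) ≡ sumBelow m (λ t → (A t - M) ℤ.* d t)
sumBelow-centre m A d M Σd≡0 = sym (begin
    sumBelow m (λ t → (A t - M) ℤ.* d t)
  ≡⟨ sumBelow-cong m (λ t _ → *-distribʳ-minus (A t) M (d t)) ⟩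
    sumBelow m (λ t → A t ℤ.* d t - M ℤ.* d t)
  ≡⟨ sumBelow-distrib-- m _ _ ⟩
    sumBelow m (λ t → A t ℤ.* d t) - sumBelow m (λ t → M ℤ.* d t)
  ≡⟨ cong (λ s → sumBelow m (λ t → A t ℤ.* d t) - s) (sumBelow-*ˡ m M d) ⟩
    sumBelow m (λ t → A t ℤ.* d t) - M ℤ.* sumBelow m d
  ≡⟨ cong (λ s → sumBelow m (λ t → A t ℤ.* d t) - M ℤ.* s) Σd≡0 ⟩
    sumBelow m (λ t → A t ℤ.* d t) - M ℤ.* 0ℤ
  ≡⟨ minus-*-zero (sumBelow m (λ t → A t ℤ.* d t)) M ⟩
    sumBelow m (λ t → A t ℤ.* d t) ∎)
  where
  open ≡-Reasoning
  *-distribʳ-minus : ∀ x y z → (x - y) ℤ.* z ≡ x ℤ.* z - y ℤ.* z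
  *-distribʳ-minus = solve-∀
  minus-*-zero : ∀ x y → x - y ℤ.* 0ℤ ≡ x
  minus-*-zero = solve-∀

i≤+∣i∣ : ∀ i → i ℤ.≤ + ∣ i ∣
i≤+∣i∣ (+ n)    = ℤP.≤-refl
i≤+∣i∣ -[1+ n ] = -≤+

∣j∣≤n⇒i*j≤n*∣i∣ : ∀ {n} i j → ∣ j ∣ ℕ.≤ n → i ℤ.* j ℤ.≤ + n ℤ.* + ∣ i ∣
∣j∣≤n⇒i*j≤n*∣i∣ {n} i j ∣j∣≤n = begin
  i ℤ.* j                ≤⟨ i≤+∣i∣ (i ℤ.* j) ⟩
  + ∣ i ℤ.* j ∣          ≡⟨ cong +_ (ℤP.∣i*j∣≡∣i∣*∣j∣ i j) ⟩
  + (∣ i ∣ ℕ.* ∣ j ∣)    ≤⟨ +≤+ (ℕP.*-monoʳ-≤ ∣ i ∣ ∣j∣≤n) ⟩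
  + (∣ i ∣ ℕ.* n)        ≡⟨ cong +_ (ℕP.*-comm ∣ i ∣ n) ⟩
  + (n ℕ.* ∣ i ∣)        ≡⟨ ℤP.pos-* n ∣ i ∣ ⟩
  + n ℤ.* + ∣ i ∣        ∎
  where open ℤP.≤-Reasoning

sumBelow-zeroSum-*-≤ : ∀ m (C : ℕ) (A d : ℕ → ℤ) (M : ℤ) →
                       sumBelow m d ≡ 0ℤ → (∀ t → t < m → ∣ d t ∣ ℕ.≤ C) →
                       sumBelow m (λ t → A t ℤ.* d t) ℤ.≤ + C ℤ.* sumBelow m (λ t → + ∣ A t - M ∣)
sumBelow-zeroSum-*-≤ m C A d M Σd≡0 ∣d∣≤C = begin
    sumBelow m (λ t → A t ℤ.* d t)
  ≡⟨ sumBelow-centre m A d M Σd≡0 ⟩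
    sumBelow m (λ t → (A t - M) ℤ.* d t)
  ≤⟨ sumBelow-mono-≤ m (λ t t<m → ∣j∣≤n⇒i*j≤n*∣i∣ (A t - M) (d t) (∣d∣≤C t t<m)) ⟩
    sumBelow m (λ t → + C ℤ.* + ∣ A t - M ∣)
  ≡⟨ sumBelow-*ˡ m (+ C) (λ t → + ∣ A t - M ∣) ⟩
    + C ℤ.* sumBelow m (λ t → + ∣ A t - M ∣) ∎
  where open ℤP.≤-Reasoning

k∸i≡1+k∸1+i : ∀ {k i} → i < k → k ∸ i ≡ suc (k ∸ suc i)
k∸i≡1+k∸1+i i<k = ℕP.+-∸-assoc 1 i<k

sumBelow-∣-∣≡pairs : ∀ k (A : ℕ → ℤ) (M : ℤ) →
                     (∀ i → i < ⌈ k /2⌉ → A i ℤ.≤ M × M ℤ.≤ A (k ∸ suc i)) →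
                     sumBelow k (λ t → + ∣ A t - M ∣) ≡ sumBelow ⌈ k /2⌉ (λ i → A (k ∸ suc i) - A i)
sumBelow-∣-∣≡pairs zero          A M between = refl
sumBelow-∣-∣≡pairs (suc zero)    A M between =
  cong (λ s → 0ℤ ℤ.+ s) (trans (ℤP.∣-∣-≤ A₀≤M) (cong (_- A 0) (ℤP.≤-antisym M≤A₀ A₀≤M)))
  where
  A₀≤M = proj₁ (between 0 z<s)
  M≤A₀ = proj₂ (between 0 z<s)
sumBelow-∣-∣≡pairs (suc (suc k)) A M between = begin
    sumBelow (suc k) g ℤ.+ g (suc k)
  ≡⟨ cong (ℤ._+ g (suc k)) (sumBelow-suc-head k g) ⟩
    (g 0 ℤ.+ sumBelow k (g ∘ suc)) ℤ.+ g (suc k)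
  ≡⟨ cong₂ (λ u v → (u ℤ.+ v) ℤ.+ g (suc k)) first inner ⟩
    ((M - A 0) ℤ.+ S) ℤ.+ g (suc k)
  ≡⟨ cong (λ s → ((M - A 0) ℤ.+ S) ℤ.+ s) last ⟩
    ((M - A 0) ℤ.+ S) ℤ.+ (A (suc k) - M)
  ≡⟨ telescope M (A 0) (A (suc k)) S ⟩
    (A (suc k) - A 0) ℤ.+ S
  ≡⟨ sym (sumBelow-suc-head ⌈ k /2⌉ pair) ⟩
    sumBelow ⌈ suc (suc k) /2⌉ pair ∎
  where
  open ≡-Reasoning
  g : ℕ → ℤ
  g t = + ∣ A t - M ∣
  pair : ℕ → ℤ
  pair i = A (suc (suc k) ∸ suc i) - A i
  S : ℤ
  S = sumBelow ⌈ k /2⌉ (pair ∘ suc)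
  outer = between 0 z<s
  first : g 0 ≡ M - A 0
  first = ℤP.∣-∣-≤ (proj₁ outer)
  last : g (suc k) ≡ A (suc k) - M
  last = trans (cong +_ (ℤP.∣i-j∣≡∣j-i∣ (A (suc k)) M)) (ℤP.∣-∣-≤ (proj₂ outer))
  i<k : ∀ {i} → i < ⌈ k /2⌉ → i < k
  i<k i<⌈k/2⌉ = ℕP.<-≤-trans i<⌈k/2⌉ (ℕP.⌈n/2⌉≤n k)
  between′ : ∀ i → i < ⌈ k /2⌉ → A (suc i) ℤ.≤ M × M ℤ.≤ A (suc (k ∸ suc i))
  between′ i i<⌈k/2⌉ with between (suc i) (s≤s i<⌈k/2⌉)
  ... | Aᵢ≤M , M≤Aₖ₋ᵢ = Aᵢ≤M , subst (λ j → M ℤ.≤ A j) (k∸i≡1+k∸1+i (i<k i<⌈k/2⌉)) M≤Aₖ₋ᵢ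
  inner : sumBelow k (g ∘ suc) ≡ S
  inner = trans (sumBelow-∣-∣≡pairs k (A ∘ suc) M between′)
                (sumBelow-cong ⌈ k /2⌉ (λ i i<⌈k/2⌉ →
                  cong (λ j → A j - A (suc i)) (sym (k∸i≡1+k∸1+i (i<k i<⌈k/2⌉)))))
  telescope : ∀ m a b s → ((m - a) ℤ.+ s) ℤ.+ (b - m) ≡ (b - a) ℤ.+ s
  telescope = solve-∀

⌈n/2⌉≤1+⌊n/2⌋ : ∀ n → ⌈ n /2⌉ ≤ suc ⌊ n /2⌋
⌈n/2⌉≤1+⌊n/2⌋ zero          = z≤n
⌈n/2⌉≤1+⌊n/2⌋ (suc zero)    = s≤s z≤n
⌈n/2⌉≤1+⌊n/2⌋ (suc (suc n)) = s≤s (⌈n/2⌉≤1+⌊n/2⌋ n)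

n/2≡⌊n/2⌋ : ∀ n → n / 2 ≡ ⌊ n /2⌋
n/2≡⌊n/2⌋ zero          = refl
n/2≡⌊n/2⌋ (suc zero)    = refl
n/2≡⌊n/2⌋ (suc (suc n)) = trans (m/n≡1+[m∸n]/n {suc (suc n)} {2} (s≤s (s≤s z≤n))) (cong suc (n/2≡⌊n/2⌋ n))

median-between-pairs : ∀ k (A : ℕ → ℤ) → (∀ {p q} → p ≤ q → q < k → A p ℤ.≤ A q) →
                       ∀ i → i < ⌈ k /2⌉ → A i ℤ.≤ A ⌊ k /2⌋ × A ⌊ k /2⌋ ℤ.≤ A (k ∸ suc i)
median-between-pairs k A mono i i<⌈k/2⌉ =
  mono i≤median (ℕP.≤-<-trans median≤mirror mirror<k) , mono median≤mirror mirror<k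
  where
  i≤median : i ≤ ⌊ k /2⌋
  i≤median = ℕ.s≤s⁻¹ (ℕP.≤-trans i<⌈k/2⌉ (⌈n/2⌉≤1+⌊n/2⌋ k))
  median≤mirror : ⌊ k /2⌋ ≤ k ∸ suc i
  median≤mirror = ℕP.m+n≤o⇒m≤o∸n ⌊ k /2⌋
    (subst (⌊ k /2⌋ ℕ.+ suc i ≤_) (ℕP.⌊n/2⌋+⌈n/2⌉≡n k) (ℕP.+-monoʳ-≤ ⌊ k /2⌋ i<⌈k/2⌉))
  mirror<k : k ∸ suc i < k
  mirror<k = ℕP.∸-monoʳ-< z<s (ℕP.<-≤-trans i<⌈k/2⌉ (ℕP.⌈n/2⌉≤n k))

allPairs-lookup : ∀ {a r} {A : Set a} {R : A → A → Set r} {xs : List A} → AllPairs R xs →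
                  ∀ {i j} → i Fin.< j → R (lookup xs i) (lookup xs j)
allPairs-lookup (Rx ∷ _)  {Fin.zero}  {Fin.suc j} _   = All.lookup Rx (∈-lookup j)
allPairs-lookup (_ ∷ Rxs) {Fin.suc i} {Fin.suc j} i<j = allPairs-lookup Rxs (ℕ.s≤s⁻¹ i<j)

length≤width+1 : ∀ {a} {A : Set a} (W : A → ℤ) (lo : ℤ) (D : ℕ) {ps : List A} →
                 All (λ p → lo ℤ.≤ W p × W p - lo ℤ.≤ + D) ps →
                 AllPairs (λ p q → W p ≢ W q) ps → length ps ≤ suc D
length≤width+1 W lo D {ps} in-range distinct = ℕP.≮⇒≥ λ overflow →
  let i , j , i<j , same-offset = FinP.pigeonhole overflow offset
  in allPairs-lookup distinct i<j (offset-determines-W same-offset)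
  where
  range : ∀ i → lo ℤ.≤ W (lookup ps i) × W (lookup ps i) - lo ℤ.≤ + D
  range i = All.lookup in-range (∈-lookup i)
  +∣offset∣ : ∀ i → + ∣ W (lookup ps i) - lo ∣ ≡ W (lookup ps i) - lo
  +∣offset∣ i = ℤP.0≤i⇒+∣i∣≡i (ℤP.i≤j⇒0≤j-i (proj₁ (range i)))
  offset : Fin (length ps) → Fin (suc D)
  offset i = fromℕ< (s≤s (ℤP.drop‿+≤+ (subst (ℤ._≤ + D) (sym (+∣offset∣ i)) (proj₂ (range i)))))
  offset-determines-W : ∀ {i j} → offset i ≡ offset j → W (lookup ps i) ≡ W (lookup ps j)
  offset-determines-W {i} {j} same = ∙-cancelʳ (ℤ.- lo) _ _ (begin
      W (lookup ps i) - lo          ≡⟨ sym (+∣offset∣ i) ⟩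
      + ∣ W (lookup ps i) - lo ∣    ≡⟨ cong +_ (sym (FinP.toℕ-fromℕ< _)) ⟩
      + toℕ (offset i)              ≡⟨ cong (+_ ∘ toℕ) same ⟩
      + toℕ (offset j)              ≡⟨ cong +_ (FinP.toℕ-fromℕ< _) ⟩
      + ∣ W (lookup ps j) - lo ∣    ≡⟨ +∣offset∣ j ⟩
      W (lookup ps j) - lo          ∎)
    where open ≡-Reasoning

length≤diameter+1 : ∀ {a} {A : Set a} (W : A → ℤ) (D : ℕ) → (∀ p q → W p - W q ℤ.≤ + D) →
                    {ps : List A} → AllPairs (λ p q → W p ≢ W q) ps → length ps ≤ suc D
length≤diameter+1 W D spread {[]}     _        = z≤n
length≤diameter+1 W D spread {p ∷ ps} distinct =
  length≤width+1 W (W lowest) D (All.map (λ {q} lowest≤q → lowest≤q , spread q lowest) lowest≤all) distinct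
  where
  lowest = argmin W p ps
  lowest≤all : All (λ q → W lowest ℤ.≤ W q) (p ∷ ps)
  lowest≤all = f[argmin]≤f[⊤] {f = W} p ps ∷ f[argmin]≤f[xs] {f = W} p ps

occ-++ : ∀ u v c → occ (u ++ v) c ≡ occ u c ℕ.+ occ v c
occ-++ u v c = trans (cong length (ListP.filter-++ (ℤP._≟ c) u v))
                     (ListP.length-++ (filter (ℤP._≟ c) u))

occ-singleton-≡ : ∀ b → occ [ b ] b ≡ 1
occ-singleton-≡ b = cong length (ListP.filter-accept (ℤP._≟ b) refl)

occ-singleton-≢ : ∀ {b c} → b ≢ c → occ [ b ] c ≡ 0
occ-singleton-≢ {c = c} b≢c = cong length (ListP.filter-reject (ℤP._≟ c) b≢c)

weight-map-1≡length : ∀ {a} {A : Set a} (xs : List A) → weight (map (λ _ → + 1) xs) ≡ + length xs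
weight-map-1≡length []       = refl
weight-map-1≡length (_ ∷ xs) = cong (λ s → + 1 ℤ.+ s) (weight-map-1≡length xs)

pairedSpread : ∀ {k} → (Fin k → ℤ) → ℤ
pairedSpread {k} a = sumBelow ⌈ k /2⌉ (λ i → at a (k ∸ suc i) - at a i)

bound≡*pairedSpread+1 : ∀ {k} C (a : Fin k → ℤ) → bound C a ≡ + C ℤ.* pairedSpread a ℤ.+ + 1
bound≡*pairedSpread+1 {k} C a =
  cong (λ m → + C ℤ.* sumBelow m (λ i → at a (k ∸ suc i) - at a i) ℤ.+ + 1) (n/2≡⌊n/2⌋ (suc k))

module _ {k : ℕ} {a : Fin k → ℤ} (a-increasing : StrictlyIncreasing a) where

  at-fromℕ< : ∀ {t} (t<k : t < k) → at a t ≡ a (fromℕ< t<k)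
  at-fromℕ< {t} t<k with t ℕ.<? k
  ... | yes t<k′ = cong a (FinP.fromℕ<-cong t t refl t<k′ t<k)
  ... | no  t≮k  = contradiction t<k t≮k

  at-toℕ : ∀ l → at a (toℕ l) ≡ a l
  at-toℕ l = trans (at-fromℕ< (FinP.toℕ<n l)) (cong a (FinP.fromℕ<-toℕ l _))

  at-mono : ∀ {p q} → p ≤ q → q < k → at a p ℤ.≤ at a q
  at-mono {p} {q} p≤q q<k with ℕP.m≤n⇒m<n∨m≡n p≤q
  ... | inj₂ refl = ℤP.≤-refl
  ... | inj₁ p<q  = subst₂ ℤ._≤_ (sym (at-fromℕ< p<k)) (sym (at-fromℕ< q<k))
    (ℤP.<⇒≤ (a-increasing _ _
      (subst₂ ℕ._<_ (sym (FinP.toℕ-fromℕ< p<k)) (sym (FinP.toℕ-fromℕ< q<k)) p<q)))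
    where p<k = ℕP.<-trans p<q q<k

  a-injective : Injective _≡_ _≡_ a
  a-injective {l} {l′} al≡al′ with ℕP.<-cmp (toℕ l) (toℕ l′)
  ... | tri< l<l′ _ _ = contradiction al≡al′ (ℤP.<⇒≢ (a-increasing l l′ l<l′))
  ... | tri≈ _ l≡l′ _ = FinP.toℕ-injective l≡l′
  ... | tri> _ _ l>l′ = contradiction (sym al≡al′) (ℤP.<⇒≢ (a-increasing l′ l l>l′))

  sumBelow-occ-letter : ∀ (f : ℕ → ℤ) l →
                        sumBelow k (λ t → f t ℤ.* + occ [ a l ] (at a t)) ≡ f (toℕ l)
  sumBelow-occ-letter f l = begin
      sumBelow k (λ t → f t ℤ.* + occ [ a l ] (at a t))
    ≡⟨ sumBelow-single k (toℕ l) (FinP.toℕ<n l) other-letter ⟩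
      f (toℕ l) ℤ.* + occ [ a l ] (at a (toℕ l))
    ≡⟨ cong (λ c → f (toℕ l) ℤ.* + occ [ a l ] c) (at-toℕ l) ⟩
      f (toℕ l) ℤ.* + occ [ a l ] (a l)
    ≡⟨ cong (λ n → f (toℕ l) ℤ.* + n) (occ-singleton-≡ (a l)) ⟩
      f (toℕ l) ℤ.* + 1
    ≡⟨ ℤP.*-identityʳ (f (toℕ l)) ⟩
      f (toℕ l) ∎
    where
    open ≡-Reasoning
    other-letter : ∀ t → t < k → t ≢ toℕ l → f t ℤ.* + occ [ a l ] (at a t) ≡ 0ℤ
    other-letter t t<k t≢l =
      trans (cong (λ n → f t ℤ.* + n) (occ-singleton-≢ al≢aₜ)) (ℤP.*-zeroʳ (f t))
      where
      al≢aₜ : a l ≢ at a t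
      al≢aₜ al≡aₜ = t≢l (trans (sym (FinP.toℕ-fromℕ< t<k))
                               (cong toℕ (sym (a-injective (trans al≡aₜ (at-fromℕ< t<k))))))

  weight-map≡sumBelow-occ : ∀ (f : ℕ → ℤ) ws →
    weight (map (f ∘ toℕ) ws) ≡ sumBelow k (λ t → f t ℤ.* + occ (map a ws) (at a t))
  weight-map≡sumBelow-occ f []       = sym (sumBelow-zero k (λ t _ → ℤP.*-zeroʳ (f t)))
  weight-map≡sumBelow-occ f (l ∷ ws) = begin
      f (toℕ l) ℤ.+ weight (map (f ∘ toℕ) ws)
    ≡⟨ cong₂ ℤ._+_ (sym (sumBelow-occ-letter f l)) (weight-map≡sumBelow-occ f ws) ⟩
      sumBelow k (λ t → f t ℤ.* + occ [ a l ] (at a t))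
        ℤ.+ sumBelow k (λ t → f t ℤ.* + occ (map a ws) (at a t))
    ≡⟨ sym (sumBelow-distrib-+ k _ _) ⟩
      sumBelow k (λ t → f t ℤ.* + occ [ a l ] (at a t) ℤ.+ f t ℤ.* + occ (map a ws) (at a t))
    ≡⟨ sumBelow-cong k (λ t _ → merge t) ⟩
      sumBelow k (λ t → f t ℤ.* + occ (a l ∷ map a ws) (at a t)) ∎
    where
    open ≡-Reasoning
    merge : ∀ t → f t ℤ.* + occ [ a l ] (at a t) ℤ.+ f t ℤ.* + occ (map a ws) (at a t)
                  ≡ f t ℤ.* + occ (a l ∷ map a ws) (at a t)
    merge t = trans (sym (ℤP.*-distribˡ-+ (f t) _ _))
                    (cong (λ n → f t ℤ.* + n) (sym (occ-++ [ a l ] (map a ws) (at a t))))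

  weight≡sumBelow-occ : ∀ ws → weight (map a ws) ≡ sumBelow k (λ t → at a t ℤ.* + occ (map a ws) (at a t))
  weight≡sumBelow-occ ws =
    trans (cong weight (ListP.map-cong (sym ∘ at-toℕ) ws)) (weight-map≡sumBelow-occ (at a) ws)

  length≡sumBelow-occ : ∀ ws → + length ws ≡ sumBelow k (λ t → + occ (map a ws) (at a t))
  length≡sumBelow-occ ws = begin
      + length ws                                               ≡⟨ sym (weight-map-1≡length ws) ⟩
      weight (map (λ _ → + 1) ws)                               ≡⟨ weight-map≡sumBelow-occ (λ _ → + 1) ws ⟩
      sumBelow k (λ t → + 1 ℤ.* + occ (map a ws) (at a t))      ≡⟨ sumBelow-cong k (λ t _ → ℤP.*-identityˡ _) ⟩
      sumBelow k (λ t → + occ (map a ws) (at a t))              ∎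
    where open ≡-Reasoning

  weight-difference-≤ : ∀ C ws vs → length ws ≡ length vs →
                        (∀ l → ∣ + occ (map a ws) (a l) - + occ (map a vs) (a l) ∣ ℕ.≤ C) →
                        weight (map a ws) - weight (map a vs) ℤ.≤ + C ℤ.* pairedSpread a
  weight-difference-≤ C ws vs same-length balanced = begin
      weight (map a ws) - weight (map a vs)
    ≡⟨ cong₂ _-_ (weight≡sumBelow-occ ws) (weight≡sumBelow-occ vs) ⟩
      sumBelow k (λ t → at a t ℤ.* count ws t) - sumBelow k (λ t → at a t ℤ.* count vs t)
    ≡⟨ sym (sumBelow-distrib-- k _ _) ⟩
      sumBelow k (λ t → at a t ℤ.* count ws t - at a t ℤ.* count vs t)
    ≡⟨ sumBelow-cong k (λ t _ → *-distribˡ-minus (at a t) (count ws t) (count vs t)) ⟩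
      sumBelow k (λ t → at a t ℤ.* d t)
    ≤⟨ sumBelow-zeroSum-*-≤ k C (at a) d M Σd≡0 ∣d∣≤C ⟩
      + C ℤ.* sumBelow k (λ t → + ∣ at a t - M ∣)
    ≡⟨ cong (λ s → + C ℤ.* s) (sumBelow-∣-∣≡pairs k (at a) M (median-between-pairs k (at a) at-mono)) ⟩
      + C ℤ.* pairedSpread a ∎
    where
    open ℤP.≤-Reasoning
    M : ℤ
    M = at a ⌊ k /2⌋
    count : List (Fin k) → ℕ → ℤ
    count us t = + occ (map a us) (at a t)
    d : ℕ → ℤ
    d t = count ws t - count vs t
    Σd≡0 : sumBelow k d ≡ 0ℤ
    Σd≡0 = trans (sumBelow-distrib-- k _ _)
           (trans (cong₂ _-_ (sym (length≡sumBelow-occ ws)) (sym (length≡sumBelow-occ vs)))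
           (trans (cong (λ m → + m - + length vs) same-length) (ℤP.+-inverseʳ (+ length vs))))
    ∣d∣≤C : ∀ t → t < k → ∣ d t ∣ ℕ.≤ C
    ∣d∣≤C t t<k = subst (λ c → ∣ + occ (map a ws) c - + occ (map a vs) c ∣ ℕ.≤ C)
                        (sym (at-fromℕ< t<k)) (balanced (fromℕ< t<k))
    *-distribˡ-minus : ∀ x y z → x ℤ.* y - x ℤ.* z ≡ x ℤ.* (y - z)
    *-distribˡ-minus = solve-∀

  factor-weights-close : ∀ {C x} → Balanced C a x → ∀ n i j →
    weight (factor a x i n) - weight (factor a x j n) ℤ.≤ + C ℤ.* pairedSpread a
  factor-weights-close {C} {x} balanced n i j =
    subst₂ (λ u v → weight u - weight v ℤ.≤ + C ℤ.* pairedSpread a)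
           (sym (factor≡map i)) (sym (factor≡map j))
      (weight-difference-≤ C (letters i) (letters j) equal-length
        (λ l → subst₂ (λ u v → ∣ + occ u (a l) - + occ v (a l) ∣ ℕ.≤ C)
                      (factor≡map i) (factor≡map j) (balanced l i j n)))
    where
    letters : ℕ → List (Fin k)
    letters s = map (λ r → x (s ℕ.+ r)) (upTo n)
    factor≡map : ∀ s → factor a x s n ≡ map a (letters s)
    factor≡map s = ListP.map-∘ (upTo n)
    equal-length : length (letters i) ≡ length (letters j)
    equal-length = trans (ListP.length-map _ (upTo n)) (sym (ListP.length-map _ (upTo n)))

proposition3p4 : (k : ℕ) (a : Fin k → ℤ) → StrictlyIncreasing a →
                 (C : ℕ) → 1 ≤ C → (x : ℕ → Fin k) → Balanced C a x →
                 (n : ℕ) → AddComplexity≤ a x n (bound C a)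
proposition3p4 k a a-increasing C _ x balanced n ps inequivalent = begin
    + length ps                   ≤⟨ +≤+ (length≤diameter+1 W ∣ D ∣ spread distinct) ⟩
    + 1 ℤ.+ + ∣ D ∣               ≡⟨ ℤP.+-comm (+ 1) (+ ∣ D ∣) ⟩
    + ∣ D ∣ ℤ.+ + 1               ≡⟨ cong (ℤ._+ + 1) +∣D∣≡D ⟩
    D ℤ.+ + 1                     ≡⟨ sym (bound≡*pairedSpread+1 C a) ⟩
    bound C a                     ∎
  where
  open ℤP.≤-Reasoning
  W : ℕ → ℤ
  W i = weight (factor a x i n)
  D : ℤ
  D = + C ℤ.* pairedSpread a
  close : ∀ i j → W i - W j ℤ.≤ D
  close = factor-weights-close a-increasing {C} {x} balanced n
  +∣D∣≡D : + ∣ D ∣ ≡ D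
  +∣D∣≡D = ℤP.0≤i⇒+∣i∣≡i (subst (ℤ._≤ D) (ℤP.+-inverseʳ (W 0)) (close 0 0))
  spread : ∀ i j → W i - W j ℤ.≤ + ∣ D ∣
  spread i j = subst (W i - W j ℤ.≤_) (sym +∣D∣≡D) (close i j)
  distinct : AllPairs (λ p q → W p ≢ W q) ps
  distinct = AllPairs.map (λ ¬equivalent Wp≡Wq →
    ¬equivalent (trans (ListP.length-map _ (upTo n)) (sym (ListP.length-map _ (upTo n))) , Wp≡Wq))
    inequivalent
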